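{- Let $\mathcal{M}$ be a regular map whose orientation-preserving automorphism group $G=\mathrm{Aut}^+(\mathcal{M})=\langle R,L\rangle$ (with $L^2=1$) is nilpotent of class $c\ge 2$. Then $\mathcal{M}$ gives rise to the symmetric dessin $\mathcal{D}=(H,x,y)$ with $x=R$, $y=R^L=L^{ -1}RL$ and $H=\langle x,y\rangle$, and $H\cong\mathrm{Aut}(\mathcal{D})$ is nilpotent of class at most $c-1$.
   Context: An (orientably) regular map $\mathcal{M}$ is described algebraically by its orientation-preserving automorphism group $G=\langle R,L\rangle$, a finite group generated by an element $R$ (rotation about a vertex) and an involution $L$ (reversing an edge). A regular dessin is a triple $(H,x,y)$ with $H$ a finite group generated by $x,y$; it is symmetric if $x\mapsto y$, $y\mapsto x$ extends to an automorphism of $H$. For a regular map with non-abelian nilpotent automorphism group the map is bipartite and $\langle R,R^L\rangle$ is the colour-preserving subgroup $\mathrm{Aut}_0^+(\mathcal{M})$. Nilpotency class: $G$ has class $c$ if its lower central series $G_1=G$, $G_{i+1}=[G_i,G]$ satisfies $G_{c+1}=1\ne G_c$. -}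

module Defs where

open import Level using (Level; _⊔_)
open import Data.Nat using (ℕ; zero; suc)
open import Data.Fin using (Fin)
open import Data.Product using (Σ; ∃; _×_; _,_; proj₁; proj₂)
open import Data.Sum using (_⊎_; inj₁; inj₂)
open import Data.Unit.Polymorphic using (⊤)
open import Relation.Nullary using (¬_)
open import Algebra.Bundles using (Group; RawGroup)
open import Algebra.Structures using (IsGroup)
import Algebra.Morphism.Structures as MS

module _ {a ℓ : Level} (G : Group a ℓ) where
  open Group G

  commutator : Carrier → Carrier → Carrier
  commutator g h = ((g ⁻¹ ∙ h ⁻¹) ∙ g) ∙ h

  conj : Carrier → Carrier → Carrier
  conj g h = (h ⁻¹ ∙ g) ∙ h

  data Gen {p : Level} (S : Carrier → Set p) : Carrier → Set (a ⊔ ℓ ⊔ p) where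
    gen  : ∀ {g} → S g → Gen S g
    gε   : Gen S ε
    g∙   : ∀ {g h} → Gen S g → Gen S h → Gen S (g ∙ h)
    ginv : ∀ {g} → Gen S g → Gen S (g ⁻¹)
    gresp : ∀ {g h} → g ≈ h → Gen S g → Gen S h

  Generated₂ : Carrier → Carrier → Set (a ⊔ ℓ)
  Generated₂ x y = ∀ g → Gen (λ h → (h ≈ x) ⊎ (h ≈ y)) g

  Finite : Set (a ⊔ ℓ)
  Finite = Σ ℕ λ n → Σ (Fin n → Carrier) λ f → ∀ g → Σ (Fin n) λ i → f i ≈ g

  -- lower central series, indexed from 1: γ 1 = G, γ (i+1) = [γ i , G]
  -- (γ 0 is also set to G, by convention; it is never used)
  γ : ℕ → Carrier → Set (a ⊔ ℓ)
  γ zero    _ = ⊤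
  γ (suc zero) _ = ⊤
  γ (suc (suc i)) = Gen (λ z → Σ Carrier λ g → Σ Carrier λ h →
                           γ (suc i) g × (z ≈ commutator g h))

  Trivial : (Carrier → Set (a ⊔ ℓ)) → Set (a ⊔ ℓ)
  Trivial P = ∀ g → P g → g ≈ ε

  ClassAtMost : ℕ → Set (a ⊔ ℓ)
  ClassAtMost c = Trivial (γ (suc c))

  HasClass : ℕ → Set (a ⊔ ℓ)
  HasClass c = ClassAtMost c × ¬ Trivial (γ c)

  IsAutomorphism : (Carrier → Carrier) → Set (a ⊔ ℓ)
  IsAutomorphism f = MS.GroupMorphisms.IsGroupIsomorphism rawGroup rawGroup f

  Sub₂ : Carrier → Carrier → Group (a ⊔ ℓ) ℓ
  Sub₂ x y = record
    { Carrier = Σ Carrier P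
    ; _≈_ = λ u v → proj₁ u ≈ proj₁ v
    ; _∙_ = λ u v → (proj₁ u ∙ proj₁ v , g∙ (proj₂ u) (proj₂ v))
    ; ε = ε , gε
    ; _⁻¹ = λ u → (proj₁ u ⁻¹ , ginv (proj₂ u))
    ; isGroup = record
      { isMonoid = record
        { isSemigroup = record
          { isMagma = record
            { isEquivalence = record
              { refl = refl ; sym = sym ; trans = trans }
            ; ∙-cong = ∙-cong }
          ; assoc = λ u v w → assoc (proj₁ u) (proj₁ v) (proj₁ w) }
        ; identity = (λ u → identityˡ (proj₁ u)) , (λ u → identityʳ (proj₁ u)) }
      ; inverse = (λ u → inverseˡ (proj₁ u)) , (λ u → inverseʳ (proj₁ u))
      ; ⁻¹-cong = ⁻¹-cong }
    }
    where P = Gen (λ h → (h ≈ x) ⊎ (h ≈ y))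

  inl⟨⟩ : (x y : Carrier) → Group.Carrier (Sub₂ x y)
  inl⟨⟩ x y = x , gen (inj₁ refl)

  inr⟨⟩ : (x y : Carrier) → Group.Carrier (Sub₂ x y)
  inr⟨⟩ x y = y , gen (inj₂ refl)

module _ {a ℓ : Level} (H : Group a ℓ) where
  open Group H

  IsRegularDessin : Carrier → Carrier → Set (a ⊔ ℓ)
  IsRegularDessin x y = Finite H × Generated₂ H x y

  IsSymmetricDessin : Carrier → Carrier → Set (a ⊔ ℓ)
  IsSymmetricDessin x y = IsRegularDessin x y ×
    Σ (Carrier → Carrier) λ φ → IsAutomorphism H φ × (φ x ≈ y) × (φ y ≈ x)

module Submission where

-- Since y = R·[R,L] we get [R,y] = [[R,L],R]⁻¹ ∈ γ₃(G).  For a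
--     normal subgroup N the elements b with [a,b] ∈ N form a subgroup, so all
--     commutators of elements of ⟨x,y⟩ lie in γ₃(G) as soon as [x,y] does; by
--     induction γₖ₊₂(H) ⊆ γₖ₊₃(G), hence γ_c(H) ⊆ γ_{c+1}(G) = 1.
--   * L ∉ H.  Otherwise H = G, so γ_c(G) = γ_c(H) ⊆ γ_{c+1}(G) = 1, contradicting
--     that G has class exactly c.
--   * Finiteness.  Every element of ⟨R, L⟩ lies in H or in HL; as L ∉ H, sending
--     g to g when g ∈ H (and to 1 otherwise) turns an enumeration of G into one of H.
--   * Symmetry.  Conjugation by the involution L maps H onto itself and swaps R, y.

open import Level using (Level; _⊔_)
open import Data.Nat using (ℕ; zero; suc; _≤_; _∸_; s≤s; z≤n)
open import Data.Fin using (Fin; zero; suc)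
open import Data.Fin.Properties using (_≟_)
open import Data.Bool using (Bool; true; false; not)
open import Data.List using (List; []; _∷_)
open import Data.Vec using (Vec; []; _∷_; lookup)
open import Data.Product using (_×_; _,_; proj₁; proj₂)
open import Data.Sum using (_⊎_; inj₁; inj₂)
open import Data.Unit.Polymorphic using (tt)
open import Data.Empty using (⊥-elim)
open import Relation.Nullary using (¬_; yes; does)
open import Relation.Binary.PropositionalEquality as ≡ using (_≡_)
open import Algebra.Bundles using (Group)
open import Defs

-- Deciding equations between group words: an expression is evaluated to a freely
-- reduced word, and expressions with the same reduced word agree in every group.
module FreeGroupWords {a ℓ : Level} (G : Group a ℓ) where
  open Group G
  open import Algebra.Properties.Group G using (ε⁻¹≈ε; ⁻¹-involutive; ⁻¹-anti-homo-∙)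
  open import Relation.Binary.Reasoning.Setoid setoid

  infixl 7 _⊕_
  data Expr (n : ℕ) : Set where
    var  : Fin n → Expr n
    _⊕_  : Expr n → Expr n → Expr n
    inv  : Expr n → Expr n
    unit : Expr n

  ⟦_⟧ : ∀ {n} → Expr n → Vec Carrier n → Carrier
  ⟦ var i ⟧  ρ = lookup ρ i
  ⟦ e ⊕ f ⟧  ρ = ⟦ e ⟧ ρ ∙ ⟦ f ⟧ ρ
  ⟦ inv e ⟧  ρ = ⟦ e ⟧ ρ ⁻¹
  ⟦ unit ⟧   ρ = ε

  Letter : ℕ → Set
  Letter n = Bool × Fin n

  ⟦_⟧ᴸ : ∀ {n} → Letter n → Vec Carrier n → Carrier
  ⟦ false , i ⟧ᴸ ρ = lookup ρ i
  ⟦ true  , i ⟧ᴸ ρ = lookup ρ i ⁻¹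

  Word : ℕ → Set
  Word n = List (Letter n)

  ⟦_⟧ᵂ : ∀ {n} → Word n → Vec Carrier n → Carrier
  ⟦ [] ⟧ᵂ    ρ = ε
  ⟦ l ∷ w ⟧ᵂ ρ = ⟦ l ⟧ᴸ ρ ∙ ⟦ w ⟧ᵂ ρ

  cancels : ∀ {n} → Letter n → Letter n → Bool
  cancels (false , i) (true  , j) = does (i ≟ j)
  cancels (true  , i) (false , j) = does (i ≟ j)
  cancels _ _ = false

  cancels-sound : ∀ {n} (l m : Letter n) ρ → cancels l m ≡ true → ⟦ l ⟧ᴸ ρ ∙ ⟦ m ⟧ᴸ ρ ≈ ε
  cancels-sound (false , i) (true , j) ρ c with i ≟ j
  ... | yes ≡.refl = inverseʳ _
  cancels-sound (true , i) (false , j) ρ c with i ≟ j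
  ... | yes ≡.refl = inverseˡ _

  push : ∀ {n} → Letter n → Word n → Word n
  push l [] = l ∷ []
  push l (m ∷ w) with cancels l m
  ... | true  = w
  ... | false = l ∷ m ∷ w

  push-sound : ∀ {n} (l : Letter n) w ρ → ⟦ push l w ⟧ᵂ ρ ≈ ⟦ l ⟧ᴸ ρ ∙ ⟦ w ⟧ᵂ ρ
  push-sound l [] ρ = refl
  push-sound l (m ∷ w) ρ with cancels l m in lm
  ... | true = begin
    ⟦ w ⟧ᵂ ρ                          ≈⟨ identityˡ _ ⟨
    ε ∙ ⟦ w ⟧ᵂ ρ                      ≈⟨ ∙-congʳ (cancels-sound l m ρ lm) ⟨
    (⟦ l ⟧ᴸ ρ ∙ ⟦ m ⟧ᴸ ρ) ∙ ⟦ w ⟧ᵂ ρ  ≈⟨ assoc _ _ _ ⟩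
    ⟦ l ⟧ᴸ ρ ∙ (⟦ m ⟧ᴸ ρ ∙ ⟦ w ⟧ᵂ ρ)  ∎
  ... | false = refl

  append : ∀ {n} → Word n → Word n → Word n
  append []      w = w
  append (l ∷ u) w = push l (append u w)

  append-sound : ∀ {n} (u w : Word n) ρ → ⟦ append u w ⟧ᵂ ρ ≈ ⟦ u ⟧ᵂ ρ ∙ ⟦ w ⟧ᵂ ρ
  append-sound []      w ρ = sym (identityˡ _)
  append-sound (l ∷ u) w ρ = begin
    ⟦ push l (append u w) ⟧ᵂ ρ      ≈⟨ push-sound l (append u w) ρ ⟩
    ⟦ l ⟧ᴸ ρ ∙ ⟦ append u w ⟧ᵂ ρ    ≈⟨ ∙-congˡ (append-sound u w ρ) ⟩
    ⟦ l ⟧ᴸ ρ ∙ (⟦ u ⟧ᵂ ρ ∙ ⟦ w ⟧ᵂ ρ) ≈⟨ assoc _ _ _ ⟨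
    ⟦ l ∷ u ⟧ᵂ ρ ∙ ⟦ w ⟧ᵂ ρ         ∎

  invert : ∀ {n} → Word n → Word n
  invert []            = []
  invert ((b , i) ∷ w) = append (invert w) ((not b , i) ∷ [])

  invert-letter : ∀ {n} (l : Letter n) ρ → ⟦ not (proj₁ l) , proj₂ l ⟧ᴸ ρ ≈ ⟦ l ⟧ᴸ ρ ⁻¹
  invert-letter (false , i) ρ = refl
  invert-letter (true  , i) ρ = sym (⁻¹-involutive _)

  invert-sound : ∀ {n} (w : Word n) ρ → ⟦ invert w ⟧ᵂ ρ ≈ ⟦ w ⟧ᵂ ρ ⁻¹
  invert-sound []      ρ = sym ε⁻¹≈ε
  invert-sound (l ∷ w) ρ = begin
    ⟦ invert (l ∷ w) ⟧ᵂ ρ                    ≈⟨ append-sound (invert w) _ ρ ⟩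
    ⟦ invert w ⟧ᵂ ρ ∙ (⟦ l′ ⟧ᴸ ρ ∙ ε)         ≈⟨ ∙-cong (invert-sound w ρ) (trans (identityʳ _) (invert-letter l ρ)) ⟩
    ⟦ w ⟧ᵂ ρ ⁻¹ ∙ ⟦ l ⟧ᴸ ρ ⁻¹                 ≈⟨ ⁻¹-anti-homo-∙ _ _ ⟨
    (⟦ l ⟧ᴸ ρ ∙ ⟦ w ⟧ᵂ ρ) ⁻¹                  ∎
    where l′ = not (proj₁ l) , proj₂ l

  normalise : ∀ {n} → Expr n → Word n
  normalise (var i) = (false , i) ∷ []
  normalise (e ⊕ f) = append (normalise e) (normalise f)
  normalise (inv e) = invert (normalise e)
  normalise unit    = []

  normalise-sound : ∀ {n} (e : Expr n) ρ → ⟦ normalise e ⟧ᵂ ρ ≈ ⟦ e ⟧ ρ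
  normalise-sound (var i) ρ = identityʳ _
  normalise-sound (e ⊕ f) ρ =
    trans (append-sound (normalise e) (normalise f) ρ) (∙-cong (normalise-sound e ρ) (normalise-sound f ρ))
  normalise-sound (inv e) ρ = trans (invert-sound (normalise e) ρ) (⁻¹-cong (normalise-sound e ρ))
  normalise-sound unit    ρ = refl

  -- equal normal forms, witnessed by ≡.refl on concrete expressions, give an identity
  prove : ∀ {n} (e f : Expr n) ρ → normalise e ≡ normalise f → ⟦ e ⟧ ρ ≈ ⟦ f ⟧ ρ
  prove e f ρ same = begin
    ⟦ e ⟧ ρ             ≈⟨ normalise-sound e ρ ⟨
    ⟦ normalise e ⟧ᵂ ρ  ≡⟨ ≡.cong (λ w → ⟦ w ⟧ᵂ ρ) same ⟩
    ⟦ normalise f ⟧ᵂ ρ  ≈⟨ normalise-sound f ρ ⟩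
    ⟦ f ⟧ ρ             ∎

  [_,_]ₑ : ∀ {n} → Expr n → Expr n → Expr n
  [ g , h ]ₑ = ((inv g ⊕ inv h) ⊕ g) ⊕ h

  _^ₑ_ : ∀ {n} → Expr n → Expr n → Expr n
  g ^ₑ h = (inv h ⊕ g) ⊕ h

  x₀ : ∀ {n} → Expr (suc n)
  x₀ = var zero
  x₁ : ∀ {n} → Expr (suc (suc n))
  x₁ = var (suc zero)
  x₂ : ∀ {n} → Expr (suc (suc (suc n)))
  x₂ = var (suc (suc zero))

module Commutators {a ℓ : Level} (G : Group a ℓ) where
  open Group G
  open FreeGroupWords G

  [_,_] : Carrier → Carrier → Carrier
  [_,_] = commutator G

  _^_ : Carrier → Carrier → Carrier
  _^_ = conj G

  ^-cong : ∀ {g h} k → g ≈ h → g ^ k ≈ h ^ k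
  ^-cong k g≈h = ∙-congʳ (∙-congˡ g≈h)

  ^-∙ : ∀ g h k → (g ∙ h) ^ k ≈ (g ^ k) ∙ (h ^ k)
  ^-∙ g h k = prove ((x₀ ⊕ x₁) ^ₑ x₂) ((x₀ ^ₑ x₂) ⊕ (x₁ ^ₑ x₂)) (g ∷ h ∷ k ∷ []) ≡.refl

  ^-ε : ∀ k → ε ^ k ≈ ε
  ^-ε k = prove (unit ^ₑ x₀) unit (k ∷ []) ≡.refl

  ^-⁻¹ : ∀ g k → (g ⁻¹) ^ k ≈ (g ^ k) ⁻¹
  ^-⁻¹ g k = prove (inv x₀ ^ₑ x₁) (inv (x₀ ^ₑ x₁)) (g ∷ k ∷ []) ≡.refl

  ^-commutator : ∀ g h k → [ g , h ] ^ k ≈ [ g ^ k , h ^ k ]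
  ^-commutator g h k = prove ([ x₀ , x₁ ]ₑ ^ₑ x₂) [ x₀ ^ₑ x₂ , x₁ ^ₑ x₂ ]ₑ (g ∷ h ∷ k ∷ []) ≡.refl

  ^-involution : ∀ g {l} → l ∙ l ≈ ε → (g ^ l) ^ l ≈ g
  ^-involution g {l} ll = begin
    (g ^ l) ^ l                  ≈⟨ prove ((x₀ ^ₑ x₁) ^ₑ x₁) ((inv (x₁ ⊕ x₁) ⊕ x₀) ⊕ (x₁ ⊕ x₁)) (g ∷ l ∷ []) ≡.refl ⟩
    (l ∙ l) ⁻¹ ∙ g ∙ (l ∙ l)     ≈⟨ ∙-cong (∙-congʳ (⁻¹-cong ll)) ll ⟩
    ε ⁻¹ ∙ g ∙ ε                 ≈⟨ prove ((inv unit ⊕ x₀) ⊕ unit) x₀ (g ∷ []) ≡.refl ⟩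
    g                            ∎
    where open import Relation.Binary.Reasoning.Setoid setoid

  comm-cong : ∀ {g g′ h h′} → g ≈ g′ → h ≈ h′ → [ g , h ] ≈ [ g′ , h′ ]
  comm-cong g≈ h≈ = ∙-cong (∙-cong (∙-cong (⁻¹-cong g≈) (⁻¹-cong h≈)) g≈) h≈

  comm-antisym : ∀ g h → [ h , g ] ≈ [ g , h ] ⁻¹
  comm-antisym g h = prove [ x₁ , x₀ ]ₑ (inv [ x₀ , x₁ ]ₑ) (g ∷ h ∷ []) ≡.refl

  comm-self : ∀ g → [ g , g ] ≈ ε
  comm-self g = prove [ x₀ , x₀ ]ₑ unit (g ∷ []) ≡.refl

  comm-εʳ : ∀ g → [ g , ε ] ≈ ε
  comm-εʳ g = prove [ x₀ , unit ]ₑ unit (g ∷ []) ≡.refl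

  -- the commutator identities making b ↦ [g,b] a homomorphism modulo normal subgroups
  comm-∙ʳ : ∀ g h k → [ g , h ∙ k ] ≈ [ g , k ] ∙ ([ g , h ] ^ k)
  comm-∙ʳ g h k = prove [ x₀ , x₁ ⊕ x₂ ]ₑ ([ x₀ , x₂ ]ₑ ⊕ ([ x₀ , x₁ ]ₑ ^ₑ x₂)) (g ∷ h ∷ k ∷ []) ≡.refl

  comm-⁻¹ʳ : ∀ g h → [ g , h ⁻¹ ] ≈ ([ g , h ] ^ (h ⁻¹)) ⁻¹
  comm-⁻¹ʳ g h = prove [ x₀ , inv x₁ ]ₑ (inv ([ x₀ , x₁ ]ₑ ^ₑ inv x₁)) (g ∷ h ∷ []) ≡.refl

  ^-as-comm : ∀ g l → g ^ l ≈ g ∙ [ g , l ]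
  ^-as-comm g l = prove (x₀ ^ₑ x₁) (x₀ ⊕ [ x₀ , x₁ ]ₑ) (g ∷ l ∷ []) ≡.refl

  comm-translate : ∀ g c → [ g , g ∙ c ] ≈ [ c , g ] ⁻¹
  comm-translate g c = prove [ x₀ , x₀ ⊕ x₁ ]ₑ (inv [ x₁ , x₀ ]ₑ) (g ∷ c ∷ []) ≡.refl

module LowerCentral {a ℓ : Level} (G : Group a ℓ) where
  open Group G
  open Commutators G

  ⟨_,_⟩ : Carrier → Carrier → Carrier → Set (a ⊔ ℓ)
  ⟨ x , y ⟩ = Gen G (λ h → (h ≈ x) ⊎ (h ≈ y))

  γ-normal : ∀ i {g} k → γ G i g → γ G i (g ^ k)
  γ-normal zero          k p = p
  γ-normal (suc zero)    k p = p
  γ-normal (suc (suc i)) k p = go p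
    where
    go : ∀ {g} → γ G (suc (suc i)) g → γ G (suc (suc i)) (g ^ k)
    go (gen (g , h , g∈γ , z≈)) =
      gen (g ^ k , h ^ k , γ-normal (suc i) k g∈γ , trans (^-cong k z≈) (^-commutator g h k))
    go gε           = gresp (sym (^-ε k)) gε
    go (g∙ p q)     = gresp (sym (^-∙ _ _ k)) (g∙ (go p) (go q))
    go (ginv p)     = gresp (sym (^-⁻¹ _ k)) (ginv (go p))
    go (gresp e p)  = gresp (^-cong k e) (go p)

  module _ (i : ℕ) where
    private
      N : Carrier → Set (a ⊔ ℓ)
      N = γ G (suc (suc i))

    comm-antisym-γ : ∀ {g h} → N [ g , h ] → N [ h , g ]
    comm-antisym-γ {g} {h} p = gresp (sym (comm-antisym g h)) (ginv p)

    comm-trivial-γ : ∀ {g h} → g ≈ h → N [ g , h ]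
    comm-trivial-γ g≈h = gresp (trans (sym (comm-self _)) (comm-cong refl g≈h)) gε

    -- for fixed g, the b with [g,b] ∈ γᵢ₊₂(G) form a subgroup, since γᵢ₊₂(G) is normal
    comm-γ-subgroup : ∀ g {p} {S : Carrier → Set p} → (∀ {s} → S s → N [ g , s ]) →
                      ∀ {b} → Gen G S b → N [ g , b ]
    comm-γ-subgroup g f (gen s) = f s
    comm-γ-subgroup g f gε = gresp (sym (comm-εʳ g)) gε
    comm-γ-subgroup g f (g∙ {b} {d} p q) =
      gresp (sym (comm-∙ʳ g b d)) (g∙ (comm-γ-subgroup g f q) (γ-normal (suc (suc i)) d (comm-γ-subgroup g f p)))
    comm-γ-subgroup g f (ginv {b} p) =
      gresp (sym (comm-⁻¹ʳ g b)) (ginv (γ-normal (suc (suc i)) (b ⁻¹) (comm-γ-subgroup g f p)))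
    comm-γ-subgroup g f (gresp e p) = gresp (comm-cong refl e) (comm-γ-subgroup g f p)

    commutators-of-⟨_,_⟩ : ∀ x y → N [ x , y ] → ∀ {u v} → ⟨ x , y ⟩ u → ⟨ x , y ⟩ v → N [ u , v ]
    commutators-of-⟨ x , y ⟩ xy u∈ v∈ =
      comm-antisym-γ (comm-γ-subgroup _ (λ s → comm-antisym-γ (generator-with s v∈)) u∈)
      where
      generators : ∀ {s t} → (s ≈ x) ⊎ (s ≈ y) → (t ≈ x) ⊎ (t ≈ y) → N [ s , t ]
      generators (inj₁ s≈x) (inj₁ t≈x) = comm-trivial-γ (trans s≈x (sym t≈x))
      generators (inj₁ s≈x) (inj₂ t≈y) = gresp (sym (comm-cong s≈x t≈y)) xy
      generators (inj₂ s≈y) (inj₁ t≈x) = comm-antisym-γ (gresp (sym (comm-cong t≈x s≈y)) xy)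
      generators (inj₂ s≈y) (inj₂ t≈y) = comm-trivial-γ (trans s≈y (sym t≈y))

      generator-with : ∀ {s v} → (s ≈ x) ⊎ (s ≈ y) → ⟨ x , y ⟩ v → N [ s , v ]
      generator-with s = comm-γ-subgroup _ (generators s)

module TwoGeneratorSubgroup {a ℓ : Level} (G : Group a ℓ) {x y : Group.Carrier G} where
  open Group G
  open Commutators G
  open LowerCentral G

  K : Group (a ⊔ ℓ) ℓ
  K = Sub₂ G x y

  generated : Generated₂ K (inl⟨⟩ G x y) (inr⟨⟩ G x y)
  generated (g , g∈) = go g∈
    where
    go : ∀ {g} (g∈ : ⟨ x , y ⟩ g) →
         Gen K (λ h → Group._≈_ K h (inl⟨⟩ G x y) ⊎ Group._≈_ K h (inr⟨⟩ G x y)) (g , g∈)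
    go (gen s)     = gen s
    go gε          = gε
    go (g∙ p q)    = g∙ (go p) (go q)
    go (ginv p)    = ginv (go p)
    go (gresp e p) = gresp e (go p)

  project : ∀ {p q} {S : Group.Carrier K → Set p} {T : Carrier → Set q} →
            (∀ {u} → S u → Gen G T (proj₁ u)) → ∀ {u} → Gen K S u → Gen G T (proj₁ u)
  project f (gen s)     = f s
  project f gε          = gε
  project f (g∙ p q)    = g∙ (project f p) (project f q)
  project f (ginv p)    = ginv (project f p)
  project f (gresp e p) = gresp e (project f p)

  γ-shift : γ G 3 [ x , y ] → ∀ k {u} → γ K (suc (suc k)) u → γ G (suc (suc (suc k))) (proj₁ u)
  γ-shift xy zero = project λ { (u , v , _ , z≈) →
    gresp (sym z≈) (commutators-of-⟨ 1 , x ⟩ y xy (proj₂ u) (proj₂ v)) }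
  γ-shift xy (suc k) = project λ { (u , v , u∈ , z≈) →
    gen (proj₁ u , proj₁ v , γ-shift xy k u∈ , z≈) }

  γ-embed : (all : ∀ g → ⟨ x , y ⟩ g) → ∀ i {g} → γ G i g → γ K i (g , all g)
  γ-embed all zero          p = tt
  γ-embed all (suc zero)    p = tt
  γ-embed all (suc (suc i)) p = go p
    where
    go : ∀ {g} → γ G (suc (suc i)) g → γ K (suc (suc i)) (g , all g)
    go (gen (g , h , g∈γ , z≈)) = gen ((g , all g) , (h , all h) , γ-embed all (suc i) g∈γ , z≈)
    go gε          = gresp refl gε
    go (g∙ p q)    = gresp refl (g∙ (go p) (go q))
    go (ginv p)    = gresp refl (ginv (go p))
    go (gresp e p) = gresp e (go p)

module RegularMap {a ℓ : Level} (G : Group a ℓ) (R L : Group.Carrier G)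
                  (gens : Generated₂ G R L) (L²≈ε : Group._≈_ G (Group._∙_ G L L) (Group.ε G)) where
  open Group G
  open FreeGroupWords G
  open Commutators G
  open LowerCentral G
  open TwoGeneratorSubgroup G {R} {R ^ L}
  open import Relation.Binary.Reasoning.Setoid setoid

  InH : Carrier → Set (a ⊔ ℓ)
  InH = ⟨ R , R ^ L ⟩

  -- R^L = R·[R,L], hence [R, R^L] = [[R,L],R]⁻¹ ∈ γ₃(G)
  generators-commute-mod-γ₃ : γ G 3 [ R , R ^ L ]
  generators-commute-mod-γ₃ =
    gresp (sym (trans (comm-cong refl (^-as-comm R L)) (comm-translate R [ R , L ])))
          (ginv (gen ([ R , L ] , R , gen (R , L , tt , refl) , refl)))

  H-class : ∀ k → ClassAtMost G (suc (suc k)) → ClassAtMost K (suc k)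
  H-class k bound u u∈γ = bound (proj₁ u) (γ-shift generators-commute-mod-γ₃ k u∈γ)

  InH-^L : ∀ {g} → InH g → InH (g ^ L)
  InH-^L (gen (inj₁ g≈R))  = gen (inj₂ (^-cong L g≈R))
  InH-^L (gen (inj₂ g≈y))  = gen (inj₁ (trans (^-cong L g≈y) (^-involution R L²≈ε)))
  InH-^L gε                = gresp (sym (^-ε L)) gε
  InH-^L (g∙ p q)          = gresp (sym (^-∙ _ _ L)) (g∙ (InH-^L p) (InH-^L q))
  InH-^L (ginv p)          = gresp (sym (^-⁻¹ _ L)) (ginv (InH-^L p))
  InH-^L (gresp e p)       = gresp (^-cong L e) (InH-^L p)

  H-is-G : InH L → ∀ g → InH g
  H-is-G L∈H g = go (gens g)
    where
    go : ∀ {g} → Gen G (λ h → (h ≈ R) ⊎ (h ≈ L)) g → InH g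
    go (gen (inj₁ g≈R)) = gen (inj₁ g≈R)
    go (gen (inj₂ g≈L)) = gresp (sym g≈L) L∈H
    go gε               = gε
    go (g∙ p q)         = g∙ (go p) (go q)
    go (ginv p)         = ginv (go p)
    go (gresp e p)      = gresp e (go p)

  -- if G has class exactly k+2 then L ∉ H: otherwise γₖ₊₂(G) ⊆ γₖ₊₂(H) ⊆ γₖ₊₃(G) = 1
  L∉H : ∀ k → ClassAtMost G (suc (suc k)) → ¬ Trivial G (γ G (suc (suc k))) → ¬ InH L
  L∉H k bound exact L∈H = exact λ g g∈γ →
    bound g (γ-shift generators-commute-mod-γ₃ k (γ-embed (H-is-G L∈H) (suc (suc k)) g∈γ))

  HL∙HL⊆H : ∀ {g h} → InH (g ∙ L) → InH (h ∙ L) → InH (g ∙ h)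
  HL∙HL⊆H {g} {h} gL hL = gresp gL·hL^L≈gh (g∙ gL (InH-^L hL))
    where
    gL·hL^L≈gh : (g ∙ L) ∙ ((h ∙ L) ^ L) ≈ g ∙ h
    gL·hL^L≈gh = begin
      (g ∙ L) ∙ ((h ∙ L) ^ L)  ≈⟨ prove ((x₀ ⊕ x₂) ⊕ ((x₁ ⊕ x₂) ^ₑ x₂)) ((x₀ ⊕ x₁) ⊕ (x₂ ⊕ x₂)) (g ∷ h ∷ L ∷ []) ≡.refl ⟩
      (g ∙ h) ∙ (L ∙ L)        ≈⟨ ∙-congˡ L²≈ε ⟩
      (g ∙ h) ∙ ε              ≈⟨ identityʳ _ ⟩
      g ∙ h                    ∎

  HL∙H⊆HL : ∀ {g h} → InH (g ∙ L) → InH h → InH ((g ∙ h) ∙ L)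
  HL∙H⊆HL {g} {h} gL h∈ = gresp gL·h^L≈ghL (g∙ gL (InH-^L h∈))
    where
    gL·h^L≈ghL : (g ∙ L) ∙ (h ^ L) ≈ (g ∙ h) ∙ L
    gL·h^L≈ghL = prove ((x₀ ⊕ x₂) ⊕ (x₁ ^ₑ x₂)) ((x₀ ⊕ x₁) ⊕ x₂) (g ∷ h ∷ L ∷ []) ≡.refl

  HL⁻¹⊆HL : ∀ {g} → InH (g ∙ L) → InH (g ⁻¹ ∙ L)
  HL⁻¹⊆HL {g} gL = gresp gL⁻¹^L≈g⁻¹L (InH-^L (ginv gL))
    where
    gL⁻¹^L≈g⁻¹L : ((g ∙ L) ⁻¹) ^ L ≈ g ⁻¹ ∙ L
    gL⁻¹^L≈g⁻¹L = begin
      ((g ∙ L) ⁻¹) ^ L          ≈⟨ prove (inv (x₀ ⊕ x₁) ^ₑ x₁) (inv (x₁ ⊕ x₁) ⊕ (inv x₀ ⊕ x₁)) (g ∷ L ∷ []) ≡.refl ⟩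
      (L ∙ L) ⁻¹ ∙ (g ⁻¹ ∙ L)   ≈⟨ ∙-congʳ (⁻¹-cong L²≈ε) ⟩
      ε ⁻¹ ∙ (g ⁻¹ ∙ L)         ≈⟨ prove (inv unit ⊕ x₀) x₀ ((g ⁻¹ ∙ L) ∷ []) ≡.refl ⟩
      g ⁻¹ ∙ L                  ∎

  H∪HL : ∀ {g} → Gen G (λ h → (h ≈ R) ⊎ (h ≈ L)) g → InH g ⊎ InH (g ∙ L)
  H∪HL (gen (inj₁ g≈R)) = inj₁ (gen (inj₁ g≈R))
  H∪HL (gen (inj₂ g≈L)) = inj₂ (gresp (sym (trans (∙-congʳ g≈L) L²≈ε)) gε)
  H∪HL gε = inj₁ gε
  H∪HL (g∙ p q) with H∪HL p | H∪HL q
  ... | inj₁ g∈ | inj₁ h∈ = inj₁ (g∙ g∈ h∈)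
  ... | inj₁ g∈ | inj₂ hL = inj₂ (gresp (sym (assoc _ _ _)) (g∙ g∈ hL))
  ... | inj₂ gL | inj₁ h∈ = inj₂ (HL∙H⊆HL gL h∈)
  ... | inj₂ gL | inj₂ hL = inj₁ (HL∙HL⊆H gL hL)
  H∪HL (ginv p) with H∪HL p
  ... | inj₁ g∈ = inj₁ (ginv g∈)
  ... | inj₂ gL = inj₂ (HL⁻¹⊆HL gL)
  H∪HL (gresp e p) with H∪HL p
  ... | inj₁ g∈ = inj₁ (gresp e g∈)
  ... | inj₂ gL = inj₂ (gresp (∙-congʳ e) gL)

  representative : ∀ g → InH g ⊎ InH (g ∙ L) → Group.Carrier K
  representative g (inj₁ g∈) = g , g∈
  representative g (inj₂ _)  = ε , gε

  -- when L ∉ H the two cases are exclusive, so every h ∈ H represents itself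
  representative-of-H : ¬ InH L → ∀ {g h} → g ≈ h → InH h → (s : InH g ⊎ InH (g ∙ L)) →
                        proj₁ (representative g s) ≈ h
  representative-of-H L∉ g≈h h∈ (inj₁ _)  = g≈h
  representative-of-H L∉ {g} g≈h h∈ (inj₂ gL) = ⊥-elim (L∉ (gresp g⁻¹gL≈L (g∙ (ginv (gresp (sym g≈h) h∈)) gL)))
    where
    g⁻¹gL≈L : g ⁻¹ ∙ (g ∙ L) ≈ L
    g⁻¹gL≈L = prove (inv x₀ ⊕ (x₀ ⊕ x₁)) x₁ (g ∷ L ∷ []) ≡.refl

  H-finite : ¬ InH L → Finite G → Finite K
  H-finite L∉ (n , enum , onto) =
    n , (λ i → representative (enum i) (H∪HL (gens (enum i)))) , λ u →
      let (i , enum-i≈u) = onto (proj₁ u)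
      in i , representative-of-H L∉ enum-i≈u (proj₂ u) (H∪HL (gens (enum i)))

  swap : Group.Carrier K → Group.Carrier K
  swap (g , g∈) = g ^ L , InH-^L g∈

  -- it is an automorphism of H, being its own inverse
  swap-automorphism : IsAutomorphism K swap
  swap-automorphism = record
    { isGroupMonomorphism = record
      { isGroupHomomorphism = record
        { isMonoidHomomorphism = record
          { isMagmaHomomorphism = record
            { isRelHomomorphism = record { cong = ^-cong L }
            ; homo = λ u v → ^-∙ (proj₁ u) (proj₁ v) L }
          ; ε-homo = ^-ε L }
        ; ⁻¹-homo = λ u → ^-⁻¹ (proj₁ u) L }
      ; injective = λ {u} {v} e →
          trans (sym (^-involution (proj₁ u) L²≈ε)) (trans (^-cong L e) (^-involution (proj₁ v) L²≈ε)) }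
    ; surjective = λ v → swap v , λ e → trans (^-cong L e) (^-involution (proj₁ v) L²≈ε) }

  symmetric : Finite G → ¬ InH L → IsSymmetricDessin K (inl⟨⟩ G R (R ^ L)) (inr⟨⟩ G R (R ^ L))
  symmetric fin L∉ = (H-finite L∉ fin , generated) , swap , swap-automorphism , refl , ^-involution R L²≈ε

theorem5p2 : {a ℓ : Level} (G : Group a ℓ) (R L : Group.Carrier G) (c : ℕ) →
    Finite G → Generated₂ G R L → Group._≈_ G (Group._∙_ G L L) (Group.ε G) →
    2 ≤ c → HasClass G c →
    IsSymmetricDessin (Sub₂ G R (conj G R L)) (inl⟨⟩ G R (conj G R L)) (inr⟨⟩ G R (conj G R L))
    × ClassAtMost (Sub₂ G R (conj G R L)) (c ∸ 1)
theorem5p2 G R L (suc (suc k)) fin gens L²≈ε (s≤s (s≤s z≤n)) (bound , exact) =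
  symmetric fin (L∉H k bound exact) , H-class k bound
  where open RegularMap G R L gens L²≈ε
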